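{- Let $r$ be a positive integer, let $k=(2r^2)^r$ and $c=k^{ -1/r}=1/(2r^2)$, and let $\mathcal{H}=\mathcal{K}^{(r)}_n(k\text{ -out})$. Then with probability tending to $1$ as $n\to\infty$, $\alpha(\mathcal{H})<cn$.
   Context: $\mathcal{K}^{(r)}_n$ is the complete $r$-graph on $[n]$ (all $r$-subsets of $[n]$ are edges). For a host hypergraph $\mathcal{H}_0$ on $V$, $\mathcal{H}_0(k\text{ -out})$ is the random subhypergraph $\bigcup_{v\in V}E_v$, where each $E_v$ is chosen uniformly from the $k$-subsets of $\{A\in\mathcal{H}_0: v\in A\}$ (or is all of this set if it has fewer than $k$ elements), independently over $v$. An independent set is a set of vertices containing no edge, and $\alpha(\mathcal{H})$ is the size of a largest independent set of $\mathcal{H}$. -}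

module Defs where

open import Data.Bool using (Bool; true; false; _∧_; not; if_then_else_)
open import Data.Nat using (ℕ; zero; suc; _*_; _^_; _≡ᵇ_; _≤ᵇ_; _<ᵇ_)
open import Data.List using (List; []; _∷_; map; concatMap; filterᵇ; length; _++_)
open import Data.Bool.ListAction using (any; all)
open import Data.Vec using (_∷_; [])
open import Data.Fin using (Fin)
open import Data.Fin.Subset using (Subset; ∣_∣; inside; outside)
open import Data.Fin.Subset.Properties using (_∈?_; _⊆?_)
open import Relation.Nullary using (does)

allSubsets : (n : ℕ) → List (Subset n)
allSubsets zero = [] ∷ []
allSubsets (suc n) = concatMap (λ s → (outside ∷ s) ∷ (inside ∷ s) ∷ []) (allSubsets n)

completeGraph : (r n : ℕ) → List (Subset n)
completeGraph r n = filterᵇ (λ A → ∣ A ∣ ≡ᵇ r) (allSubsets n)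

choose : {A : Set} → ℕ → List A → List (List A)
choose zero xs = [] ∷ []
choose (suc k) [] = []
choose (suc k) (x ∷ xs) = map (x ∷_) (choose k xs) ++ choose (suc k) xs

star : {n : ℕ} → List (Subset n) → Fin n → List (Subset n)
star H v = filterᵇ (λ A → does (v ∈? A)) H

-- The possible (equally likely) values of E_v: a uniform k-subset of the star of v,
-- or the whole star if it has fewer than k edges.
choicesAt : {n : ℕ} → ℕ → List (Subset n) → Fin n → List (List (Subset n))
choicesAt k H v = if length (star H v) <ᵇ k then star H v ∷ [] else choose k (star H v)

product : {A : Set} → List (List A) → List (List A)
product [] = [] ∷ []
product (xs ∷ xss) = concatMap (λ x → map (x ∷_) (product xss)) xs

allVertices : (n : ℕ) → List (Fin n)
allVertices n = Data.List.allFin n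
  where import Data.List

-- Sample space of H0(k-out): one outcome = the tuple (E_v)_{v ∈ V}; all outcomes are
-- equally likely (independent uniform choices).
kOutOutcomes : {n : ℕ} → ℕ → List (Subset n) → List (List (List (Subset n)))
kOutOutcomes {n} k H = product (map (choicesAt k H) (allVertices n))

kOutGraph : {n : ℕ} → List (List (Subset n)) → List (Subset n)
kOutGraph ω = concatMap (λ E → E) ω

isIndependent : {n : ℕ} → List (Subset n) → Subset n → Bool
isIndependent H I = all (λ A → not (does (A ⊆? I))) H

-- The "bad" event α(H) ≥ c n with c = 1/(2r²), i.e. n ≤ 2r²·α(H):
-- some independent set I with n ≤ 2 r² |I|.
badEvent : (r : ℕ) {n : ℕ} → List (Subset n) → Bool
badEvent r {n} H = any (λ I → isIndependent H I ∧ (n ≤ᵇ 2 * (r * r) * ∣ I ∣)) (allSubsets n)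

kOf : ℕ → ℕ
kOf r = (2 * (r * r)) ^ r

badCount : (r n : ℕ) → ℕ
badCount r n = length (filterᵇ (λ ω → badEvent r (kOutGraph ω)) (kOutOutcomes (kOf r) (completeGraph r n)))

totalCount : (r n : ℕ) → ℕ
totalCount r n = length (kOutOutcomes {n} (kOf r) (completeGraph r n))

-- Put w = 2r², s = ⌊n / w⌋ and k = w^r. If α ≥ n / w then some s-set J is independent, and J is
-- independent only if every v ∈ J chooses E_v among the edges of its star not inside J. The star
-- of v has D = C(n-1, r-1) edges, e = C(s-1, r-1) of them inside J, and D ≤ (1 + w^(r-1)) e for
-- large n; so only a fraction C(D-e, k) / C(D, k) ≤ (1 - e/D)^k ≤ (2/3)^(2w) of the choices at v
-- qualify (Bernoulli's inequality). The choices at different vertices are independent, so J is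
-- independent in at most a (4/9)^(ws) fraction of the outcomes, and the union bound over the
-- 2^n ≤ 2^(ws+w) sets J leaves 2^w (8/9)^(ws), which is eventually below any 1/(m+1).

module Submission where

open import Defs hiding (product)
open import Data.Bool using (Bool; true; false; T; _∧_; _∨_; not)
open import Data.Bool.ListAction using (all; any)
open import Data.Bool.Properties using (∧-zeroʳ; ∧-comm; ∧-assoc; T-∧)
open import Data.Empty using (⊥-elim)
open import Data.Fin using (Fin; zero; suc)
open import Data.Fin.Subset using (Subset; ∣_∣; inside; outside; ⁅_⁆; ⊤; ⊥; _∈_; _⊆_)
open import Data.Fin.Subset.Properties
  using (_∈?_; _⊆?_; ⊆-trans; ⊥⊆; ⊆⊤; out⊆; in⊆in; drop-∷-⊆; p⊆q⇒∣p∣≤∣q∣; ∣⊥∣≡0; ∣⊤∣≡n; ∣⁅x⁆∣≡1; x∈⁅x⁆; x∈⁅y⁆⇒x≡y)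
open import Data.List using (List; []; _∷_; _++_; length; map; concatMap; filterᵇ; tabulate; allFin)
open import Data.List.Membership.Propositional using (lose) renaming (_∈_ to _∈ˡ_)
open import Data.List.Membership.Propositional.Properties using (∈-concatMap⁺)
open import Data.List.Properties using (length-++; length-map; length-filter; filter-++; map-tabulate)
open import Data.List.Relation.Unary.Any using (here; there; satisfied)
import Data.List.Relation.Unary.Any as Any
open import Data.List.Relation.Unary.Any.Properties using (any⁺; any⁻)
open import Data.Nat
open import Data.Nat.Combinatorics using (_C_; nCk+nC[k+1]≡[n+1]C[k+1]; nCk≡nPk/k!; k>n⇒nCk≡0; nPk≡n!/[n∸k]!)
open import Data.Nat.Combinatorics.Base using (_P′_; _P_)
open import Data.Nat.Combinatorics.Specification using (nP′k≡n!/[n∸k]!; k!∣nP′k; nP′k≡n[n∸1P′k∸1])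
open import Data.Nat.Divisibility using (_∣_)
open import Data.Nat.DivMod using (m/n*n≡m; m*n/n≡m; /-monoˡ-≤; m≡m%n+[m/n]*n; m%n<n)
open import Data.Nat.ListAction using (sum; product)
open import Data.Nat.Properties
open import Data.Nat.Tactic.RingSolver using (solve-∀)
open import Data.Product using (∃-syntax; _×_; _,_)
open import Data.Vec using ([]; _∷_) renaming (here to hereᵛ; there to thereᵛ)
open import Function using (_∘_; id)
open import Function.Bundles using (_⇔_; mk⇔; Equivalence)
open import Relation.Binary.PropositionalEquality
import Algebra.Properties.CommutativeSemigroup *-commutativeSemigroup as *-CS
open import Relation.Nullary using (does; yes; no)
open import Relation.Nullary.Decidable using (T?; dec-true; dec-false; does-⇔)

-- Counting with Boolean predicates

count : {A : Set} → (A → Bool) → List A → ℕ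
count p xs = length (filterᵇ p xs)

module _ {A : Set} where

  count≤length : (p : A → Bool) (xs : List A) → count p xs ≤ length xs
  count≤length p = length-filter (T? ∘ p)

  count-++ : (p : A → Bool) (xs ys : List A) → count p (xs ++ ys) ≡ count p xs + count p ys
  count-++ p xs ys = trans (cong length (filter-++ (T? ∘ p) xs ys)) (length-++ (filterᵇ p xs))

  count-cong : {p q : A → Bool} → (∀ x → p x ≡ q x) → (xs : List A) → count p xs ≡ count q xs
  count-cong p≗q [] = refl
  count-cong {p} {q} p≗q (x ∷ xs) with p x | q x | p≗q x
  ... | true  | true  | _ = cong suc (count-cong p≗q xs)
  ... | false | false | _ = count-cong p≗q xs

  count-none : {p : A → Bool} → (∀ x → p x ≡ false) → (xs : List A) → count p xs ≡ 0
  count-none p≗false [] = refl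
  count-none {p} p≗false (x ∷ xs) with p x | p≗false x
  ... | false | _ = count-none p≗false xs

  count-mono : {p q : A → Bool} → (∀ x → T (p x) → T (q x)) → (xs : List A) → count p xs ≤ count q xs
  count-mono p⇒q [] = z≤n
  count-mono {p} {q} p⇒q (x ∷ xs) with p x | q x | p⇒q x
  ... | true  | true  | _ = s≤s (count-mono p⇒q xs)
  ... | true  | false | px⇒qx = ⊥-elim (px⇒qx _)
  ... | false | true  | _ = m≤n⇒m≤1+n (count-mono p⇒q xs)
  ... | false | false | _ = count-mono p⇒q xs

  count-filterᵇ : (p q : A → Bool) (xs : List A) → count p (filterᵇ q xs) ≡ count (λ x → q x ∧ p x) xs
  count-filterᵇ p q [] = refl
  count-filterᵇ p q (x ∷ xs) with q x
  ... | false = count-filterᵇ p q xs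
  ... | true with p x
  ...   | true  = cong suc (count-filterᵇ p q xs)
  ...   | false = count-filterᵇ p q xs

  count+count-not : (p : A → Bool) (xs : List A) → count p xs + count (not ∘ p) xs ≡ length xs
  count+count-not p [] = refl
  count+count-not p (x ∷ xs) with p x
  ... | true  = cong suc (count+count-not p xs)
  ... | false = trans (+-suc _ _) (cong suc (count+count-not p xs))

  count-∨ : (p q : A → Bool) (xs : List A) → count (λ x → p x ∨ q x) xs ≤ count p xs + count q xs
  count-∨ p q [] = z≤n
  count-∨ p q (x ∷ xs) with p x | q x
  ... | true  | true  = s≤s (≤-trans (count-∨ p q xs) (+-monoʳ-≤ (count p xs) (n≤1+n _)))
  ... | true  | false = s≤s (count-∨ p q xs)
  ... | false | true  = ≤-trans (s≤s (count-∨ p q xs)) (≤-reflexive (sym (+-suc _ _)))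
  ... | false | false = count-∨ p q xs

module _ {A B : Set} where

  count-any≤sum : (F : B → A → Bool) (js : List B) (xs : List A) →
                  count (λ x → any (λ j → F j x) js) xs ≤ sum (map (λ j → count (F j) xs) js)
  count-any≤sum F [] xs = ≤-reflexive (count-none (λ _ → refl) xs)
  count-any≤sum F (j ∷ js) xs = ≤-trans (count-∨ (F j) _ xs) (+-monoʳ-≤ (count (F j) xs) (count-any≤sum F js xs))

  count-map : (p : A → Bool) (f : B → A) (ys : List B) → count p (map f ys) ≡ count (p ∘ f) ys
  count-map p f [] = refl
  count-map p f (y ∷ ys) with p (f y)
  ... | true  = cong suc (count-map p f ys)
  ... | false = count-map p f ys

sum-map*≤length* : {B : Set} (f : B → ℕ) (X M : ℕ) → (∀ j → f j * X ≤ M) → (js : List B) →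
                   sum (map f js) * X ≤ length js * M
sum-map*≤length* f X M bound [] = z≤n
sum-map*≤length* f X M bound (j ∷ js) =
  ≤-trans (≤-reflexive (*-distribʳ-+ X (f j) (sum (map f js)))) (+-mono-≤ (bound j) (sum-map*≤length* f X M bound js))

module _ {A : Set} (p : A → Bool) where

  all-++ : (xs ys : List A) → all p (xs ++ ys) ≡ all p xs ∧ all p ys
  all-++ []       ys = refl
  all-++ (x ∷ xs) ys = trans (cong (p x ∧_) (all-++ xs ys)) (sym (∧-assoc (p x) (all p xs) (all p ys)))

  0<count⇒all-not≡false : (xs : List A) → 0 < count p xs → all (not ∘ p) xs ≡ false
  0<count⇒all-not≡false (x ∷ xs) 0<count with p x
  ... | true  = refl
  ... | false = 0<count⇒all-not≡false xs 0<count

-- Products and k-subsets of lists of choices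

module _ {A : Set} where

  length-concatMap-map-∷ : (yss : List (List A)) (xs : List A) →
                            length (concatMap (λ x → map (x ∷_) yss) xs) ≡ length xs * length yss
  length-concatMap-map-∷ yss [] = refl
  length-concatMap-map-∷ yss (x ∷ xs) = begin
    length (map (x ∷_) yss ++ concatMap (λ x → map (x ∷_) yss) xs)   ≡⟨ length-++ (map (x ∷_) yss) ⟩
    length (map (x ∷_) yss) + length (concatMap (λ x → map (x ∷_) yss) xs)
      ≡⟨ cong₂ _+_ (length-map (x ∷_) yss) (length-concatMap-map-∷ yss xs) ⟩
    length yss + length xs * length yss                               ∎
    where open ≡-Reasoning

  length-product : (xss : List (List A)) → length (Defs.product xss) ≡ product (map length xss)
  length-product [] = refl
  length-product (xs ∷ xss) =
    trans (length-concatMap-map-∷ (Defs.product xss) xs) (cong (length xs *_) (length-product xss))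

  length-choose : (k : ℕ) (xs : List A) → length (choose k xs) ≡ length xs C k
  length-choose zero    xs       = refl
  length-choose (suc k) []       = refl
  length-choose (suc k) (x ∷ xs) = begin
    length (map (x ∷_) (choose k xs) ++ choose (suc k) xs)          ≡⟨ length-++ (map (x ∷_) (choose k xs)) ⟩
    length (map (x ∷_) (choose k xs)) + length (choose (suc k) xs)
      ≡⟨ cong₂ _+_ (trans (length-map (x ∷_) (choose k xs)) (length-choose k xs)) (length-choose (suc k) xs) ⟩
    length xs C k + length xs C suc k                               ≡⟨ nCk+nC[k+1]≡[n+1]C[k+1] (length xs) k ⟩
    suc (length xs) C suc k                                         ∎
    where open ≡-Reasoning

module _ {A : Set} (q : A → Bool) where

  count-all-map-∷ : ∀ {x} → q x ≡ true → (ys : List (List A)) → count (all q) (map (x ∷_) ys) ≡ count (all q) ys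
  count-all-map-∷ {x} qx ys = trans (count-map (all q) (x ∷_) ys) (count-cong (λ y → cong (_∧ all q y) qx) ys)

  count-all-map-∷-false : ∀ {x} → q x ≡ false → (ys : List (List A)) → count (all q) (map (x ∷_) ys) ≡ 0
  count-all-map-∷-false {x} qx ys = trans (count-map (all q) (x ∷_) ys) (count-none (λ y → cong (_∧ all q y) qx) ys)

  count-all-concatMap-map-∷ : (yss : List (List A)) (xs : List A) →
                               count (all q) (concatMap (λ x → map (x ∷_) yss) xs) ≡ count q xs * count (all q) yss
  count-all-concatMap-map-∷ yss [] = refl
  count-all-concatMap-map-∷ yss (x ∷ xs) with q x in qx
  ... | true  = trans (count-++ (all q) (map (x ∷_) yss) _)
                      (cong₂ _+_ (count-all-map-∷ qx yss) (count-all-concatMap-map-∷ yss xs))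
  ... | false = trans (count-++ (all q) (map (x ∷_) yss) _)
                      (cong₂ _+_ (count-all-map-∷-false qx yss) (count-all-concatMap-map-∷ yss xs))

  count-all-product : (xss : List (List A)) → count (all q) (Defs.product xss) ≡ product (map (count q) xss)
  count-all-product [] = refl
  count-all-product (xs ∷ xss) =
    trans (count-all-concatMap-map-∷ (Defs.product xss) xs) (cong (count q xs *_) (count-all-product xss))

  count-all-choose : (k : ℕ) (xs : List A) → count (all q) (choose k xs) ≡ count q xs C k
  count-all-choose zero    xs       = refl
  count-all-choose (suc k) []       = refl
  count-all-choose (suc k) (x ∷ xs) with q x in qx
  ... | true  = begin
    count (all q) (map (x ∷_) (choose k xs) ++ choose (suc k) xs)
      ≡⟨ count-++ (all q) (map (x ∷_) (choose k xs)) _ ⟩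
    count (all q) (map (x ∷_) (choose k xs)) + count (all q) (choose (suc k) xs)
      ≡⟨ cong₂ _+_ (trans (count-all-map-∷ qx (choose k xs)) (count-all-choose k xs)) (count-all-choose (suc k) xs) ⟩
    count q xs C k + count q xs C suc k
      ≡⟨ nCk+nC[k+1]≡[n+1]C[k+1] (count q xs) k ⟩
    suc (count q xs) C suc k ∎
    where open ≡-Reasoning
  ... | false = trans (count-++ (all q) (map (x ∷_) (choose k xs)) _)
                      (cong₂ _+_ (count-all-map-∷-false qx (choose k xs)) (count-all-choose (suc k) xs))

product-tabulate-*-^-≤ : ∀ {n} (f g : Fin n → ℕ) (I : Subset n) (R Q : ℕ) →
                         (∀ v → f v ≤ g v) → (∀ v → v ∈ I → f v * R ≤ g v * Q) →
                         product (tabulate f) * R ^ ∣ I ∣ ≤ product (tabulate g) * Q ^ ∣ I ∣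
product-tabulate-*-^-≤ f g [] R Q f≤g on-I = ≤-refl
product-tabulate-*-^-≤ f g (inside ∷ I) R Q f≤g on-I = begin
  f zero * F * (R * R ^ ∣ I ∣)   ≡⟨ *-CS.interchange (f zero) F R (R ^ ∣ I ∣) ⟩
  f zero * R * (F * R ^ ∣ I ∣)   ≤⟨ *-mono-≤ (on-I zero hereᵛ) rest ⟩
  g zero * Q * (G * Q ^ ∣ I ∣)   ≡⟨ *-CS.interchange (g zero) Q G (Q ^ ∣ I ∣) ⟩
  g zero * G * (Q * Q ^ ∣ I ∣)   ∎
  where
  open ≤-Reasoning
  F = product (tabulate (f ∘ suc))
  G = product (tabulate (g ∘ suc))
  rest : F * R ^ ∣ I ∣ ≤ G * Q ^ ∣ I ∣
  rest = product-tabulate-*-^-≤ (f ∘ suc) (g ∘ suc) I R Q (f≤g ∘ suc) (λ v → on-I (suc v) ∘ thereᵛ)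
product-tabulate-*-^-≤ f g (outside ∷ I) R Q f≤g on-I = begin
  f zero * F * R ^ ∣ I ∣   ≡⟨ *-assoc (f zero) F (R ^ ∣ I ∣) ⟩
  f zero * (F * R ^ ∣ I ∣) ≤⟨ *-mono-≤ (f≤g zero) rest ⟩
  g zero * (G * Q ^ ∣ I ∣) ≡⟨ *-assoc (g zero) G (Q ^ ∣ I ∣) ⟨
  g zero * G * Q ^ ∣ I ∣   ∎
  where
  open ≤-Reasoning
  F = product (tabulate (f ∘ suc))
  G = product (tabulate (g ∘ suc))
  rest : F * R ^ ∣ I ∣ ≤ G * Q ^ ∣ I ∣
  rest = product-tabulate-*-^-≤ (f ∘ suc) (g ∘ suc) I R Q (f≤g ∘ suc) (λ v → on-I (suc v) ∘ thereᵛ)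

-- Subsets of Fin n

_⊆ᵇ_ : ∀ {n} → Subset n → Subset n → Bool
p ⊆ᵇ q = does (p ⊆? q)

∈⇔⁅⁆⊆ : ∀ {n} {v : Fin n} {A : Subset n} → v ∈ A ⇔ ⁅ v ⁆ ⊆ A
∈⇔⁅⁆⊆ {v = v} {A} = mk⇔ (λ v∈A {x} x∈⁅v⁆ → subst (_∈ A) (sym (x∈⁅y⁆⇒x≡y v x∈⁅v⁆)) v∈A) (λ ⁅v⁆⊆A → ⁅v⁆⊆A (x∈⁅x⁆ v))

module _ {n : ℕ} where

  count-allSubsets-suc : (p : Subset (suc n) → Bool) →
    count p (allSubsets (suc n)) ≡ count (p ∘ (outside ∷_)) (allSubsets n) + count (p ∘ (inside ∷_)) (allSubsets n)
  count-allSubsets-suc p = go (allSubsets n)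
    where
    go : (xs : List (Subset n)) → count p (concatMap (λ s → (outside ∷ s) ∷ (inside ∷ s) ∷ []) xs)
                                  ≡ count (p ∘ (outside ∷_)) xs + count (p ∘ (inside ∷_)) xs
    go [] = refl
    go (x ∷ xs) with p (outside ∷ x)
    ... | true  with p (inside ∷ x)
    ...   | true  = cong suc (trans (cong suc (go xs)) (sym (+-suc _ _)))
    ...   | false = cong suc (go xs)
    go (x ∷ xs) | false with p (inside ∷ x)
    ...   | true  = trans (cong suc (go xs)) (sym (+-suc _ _))
    ...   | false = go xs

length-allSubsets : ∀ n → length (allSubsets n) ≡ 2 ^ n
length-allSubsets zero    = refl
length-allSubsets (suc n) = trans (doubling (allSubsets n)) (cong (2 *_) (length-allSubsets n))
  where
  doubling : (xs : List (Subset n)) → length (concatMap (λ s → (outside ∷ s) ∷ (inside ∷ s) ∷ []) xs) ≡ 2 * length xs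
  doubling []       = refl
  doubling (x ∷ xs) = trans (cong (2 +_) (doubling xs)) (sym (*-suc 2 (length xs)))

between : ∀ {n} → Subset n → Subset n → ℕ → Subset n → Bool
between L J t A = L ⊆ᵇ A ∧ (A ⊆ᵇ J ∧ (∣ A ∣ ≡ᵇ ∣ L ∣ + t))

count-between : ∀ {n} (L J : Subset n) → L ⊆ J → ∀ t → count (between L J t) (allSubsets n) ≡ (∣ J ∣ ∸ ∣ L ∣) C t
count-between [] [] _ zero    = refl
count-between [] [] _ (suc t) = refl
count-between {suc n} (outside ∷ L) (outside ∷ J) L⊆J t = begin
  count (between (outside ∷ L) (outside ∷ J) t) (allSubsets (suc n))
    ≡⟨ count-allSubsets-suc (between (outside ∷ L) (outside ∷ J) t) ⟩
  count (between L J t) (allSubsets n) + count (λ A → L ⊆ᵇ A ∧ false) (allSubsets n)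
    ≡⟨ cong₂ _+_ (count-between L J (drop-∷-⊆ L⊆J) t) (count-none (λ A → ∧-zeroʳ (L ⊆ᵇ A)) (allSubsets n)) ⟩
  (∣ J ∣ ∸ ∣ L ∣) C t + 0
    ≡⟨ +-identityʳ _ ⟩
  (∣ J ∣ ∸ ∣ L ∣) C t ∎
  where open ≡-Reasoning
count-between {suc n} (outside ∷ L) (inside ∷ J) L⊆J zero =
  trans (count-allSubsets-suc (between (outside ∷ L) (inside ∷ J) zero))
        (cong₂ _+_ (count-between L J (drop-∷-⊆ L⊆J) zero) (count-none too-big (allSubsets n)))
  where
  too-big : ∀ A → L ⊆ᵇ A ∧ (A ⊆ᵇ J ∧ (suc ∣ A ∣ ≡ᵇ ∣ L ∣ + 0)) ≡ false
  too-big A with L ⊆? A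
  ... | no  _   = refl
  ... | yes L⊆A = trans (cong (A ⊆ᵇ J ∧_) (dec-false (suc ∣ A ∣ ≟ ∣ L ∣ + 0) size-mismatch)) (∧-zeroʳ (A ⊆ᵇ J))
    where size-mismatch : suc ∣ A ∣ ≢ ∣ L ∣ + 0
          size-mismatch eq = 1+n≰n (≤-trans (≤-reflexive (trans eq (+-identityʳ ∣ L ∣))) (p⊆q⇒∣p∣≤∣q∣ L⊆A))
count-between {suc n} (outside ∷ L) (inside ∷ J) L⊆J (suc t) = begin
  count (between (outside ∷ L) (inside ∷ J) (suc t)) (allSubsets (suc n))
    ≡⟨ count-allSubsets-suc (between (outside ∷ L) (inside ∷ J) (suc t)) ⟩
  count (between L J (suc t)) (allSubsets n) + count (between (outside ∷ L) (inside ∷ J) (suc t) ∘ (inside ∷_)) (allSubsets n)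
    ≡⟨ cong (count (between L J (suc t)) (allSubsets n) +_) (count-cong (λ A → cong (λ m → L ⊆ᵇ A ∧ (A ⊆ᵇ J ∧ (suc ∣ A ∣ ≡ᵇ m))) (+-suc ∣ L ∣ t)) (allSubsets n)) ⟩
  count (between L J (suc t)) (allSubsets n) + count (between L J t) (allSubsets n)
    ≡⟨ cong₂ _+_ (count-between L J L⊆J′ (suc t)) (count-between L J L⊆J′ t) ⟩
  (∣ J ∣ ∸ ∣ L ∣) C suc t + (∣ J ∣ ∸ ∣ L ∣) C t ≡⟨ +-comm ((∣ J ∣ ∸ ∣ L ∣) C suc t) _ ⟩
  (∣ J ∣ ∸ ∣ L ∣) C t + (∣ J ∣ ∸ ∣ L ∣) C suc t ≡⟨ nCk+nC[k+1]≡[n+1]C[k+1] (∣ J ∣ ∸ ∣ L ∣) t ⟩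
  suc (∣ J ∣ ∸ ∣ L ∣) C suc t                   ≡⟨ cong (_C suc t) (+-∸-assoc 1 (p⊆q⇒∣p∣≤∣q∣ L⊆J′)) ⟨
  (suc ∣ J ∣ ∸ ∣ L ∣) C suc t                   ∎
  where open ≡-Reasoning
        L⊆J′ : L ⊆ J
        L⊆J′ = drop-∷-⊆ L⊆J
count-between {suc n} (inside ∷ L) (inside ∷ J) L⊆J t =
  trans (count-allSubsets-suc (between (inside ∷ L) (inside ∷ J) t))
        (cong₂ _+_ (count-none (λ _ → refl) (allSubsets n)) (count-between L J (drop-∷-⊆ L⊆J) t))
count-between (inside ∷ L) (outside ∷ J) L⊆J t with () ← L⊆J hereᵛ

∈-allSubsets : ∀ {n} (J : Subset n) → J ∈ˡ allSubsets n
∈-allSubsets []            = here refl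
∈-allSubsets (outside ∷ J) = ∈-concatMap⁺ _ (Any.map (λ { refl → here refl }) (∈-allSubsets J))
∈-allSubsets (inside ∷ J)  = ∈-concatMap⁺ _ (Any.map (λ { refl → there (here refl) }) (∈-allSubsets J))

subset-of-size : ∀ {n} (I : Subset n) t → t ≤ ∣ I ∣ → ∃[ J ] J ⊆ I × ∣ J ∣ ≡ t
subset-of-size {n} I zero _ = ⊥ , ⊥⊆ , ∣⊥∣≡0 n
subset-of-size (inside ∷ I) (suc t) (s≤s t≤∣I∣) with subset-of-size I t t≤∣I∣
... | J , J⊆I , ∣J∣≡t = inside ∷ J , in⊆in J⊆I , cong suc ∣J∣≡t
subset-of-size (outside ∷ I) (suc t) t≤∣I∣ with subset-of-size I (suc t) t≤∣I∣
... | J , J⊆I , ∣J∣≡t = outside ∷ J , out⊆ J⊆I , ∣J∣≡t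

-- Independent sets of k-out hypergraphs

isIndependent-kOutGraph : ∀ {n} (J : Subset n) (ω : List (List (Subset n))) →
                          isIndependent (kOutGraph ω) J ≡ all (λ E → isIndependent E J) ω
isIndependent-kOutGraph J []      = refl
isIndependent-kOutGraph J (E ∷ ω) =
  trans (all-++ (λ A → not (A ⊆ᵇ J)) E (kOutGraph ω)) (cong (isIndependent E J ∧_) (isIndependent-kOutGraph J ω))

isIndependent-⊆ : ∀ {n} {J I : Subset n} (H : List (Subset n)) → J ⊆ I → T (isIndependent H I) → T (isIndependent H J)
isIndependent-⊆ []      J⊆I _ = _
isIndependent-⊆ {J = J} {I} (A ∷ H) J⊆I indep with A ⊆? I | A ⊆? J
... | no _  | no _    = isIndependent-⊆ H J⊆I indep
... | no A⊈I | yes A⊆J = A⊈I (⊆-trans A⊆J J⊆I)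

map-map-allFin : ∀ {n} {A B : Set} (f : A → B) (g : Fin n → A) → map f (map g (allFin n)) ≡ tabulate (f ∘ g)
map-map-allFin f g = trans (cong (map f) (map-tabulate id g)) (map-tabulate g f)

module _ {n : ℕ} (k : ℕ) (H : List (Subset n)) where

  length-kOutOutcomes : length (kOutOutcomes k H) ≡ product (tabulate (length ∘ choicesAt k H))
  length-kOutOutcomes = begin
    length (Defs.product (map (choicesAt k H) (allFin n)))   ≡⟨ length-product (map (choicesAt k H) (allFin n)) ⟩
    product (map length (map (choicesAt k H) (allFin n)))   ≡⟨ cong product (map-map-allFin length (choicesAt k H)) ⟩
    product (tabulate (length ∘ choicesAt k H))              ∎
    where open ≡-Reasoning

  count-independent-kOutOutcomes : (J : Subset n) →
    count (λ ω → isIndependent (kOutGraph ω) J) (kOutOutcomes k H)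
      ≡ product (tabulate (count (λ E → isIndependent E J) ∘ choicesAt k H))
  count-independent-kOutOutcomes J = begin
    count (λ ω → isIndependent (kOutGraph ω) J) (kOutOutcomes k H)
      ≡⟨ count-cong (isIndependent-kOutGraph J) (kOutOutcomes k H) ⟩
    count (all (λ E → isIndependent E J)) (Defs.product (map (choicesAt k H) (allFin n)))
      ≡⟨ count-all-product (λ E → isIndependent E J) (map (choicesAt k H) (allFin n)) ⟩
    product (map (count (λ E → isIndependent E J)) (map (choicesAt k H) (allFin n)))
      ≡⟨ cong product (map-map-allFin (count (λ E → isIndependent E J)) (choicesAt k H)) ⟩
    product (tabulate (count (λ E → isIndependent E J) ∘ choicesAt k H)) ∎
    where open ≡-Reasoning

  count-independent-choicesAt-≤ : (J : Subset n) (v : Fin n) (R Q : ℕ) →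
    0 < count (_⊆ᵇ J) (star H v) →
    (count (not ∘ (_⊆ᵇ J)) (star H v) C k) * R ≤ (length (star H v) C k) * Q →
    count (λ E → isIndependent E J) (choicesAt k H v) * R ≤ length (choicesAt k H v) * Q
  count-independent-choicesAt-≤ J v R Q J-has-edge bound with length (star H v) <ᵇ k
  ... | true  rewrite 0<count⇒all-not≡false (_⊆ᵇ J) (star H v) J-has-edge = z≤n
  ... | false = subst₂ (λ a b → a * R ≤ b * Q)
                       (sym (count-all-choose (not ∘ (_⊆ᵇ J)) k (star H v))) (sym (length-choose k (star H v))) bound

  count-independent-kOutOutcomes-≤ : (J : Subset n) (R Q : ℕ) →
    (∀ v → v ∈ J → count (λ E → isIndependent E J) (choicesAt k H v) * R ≤ length (choicesAt k H v) * Q) →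
    count (λ ω → isIndependent (kOutGraph ω) J) (kOutOutcomes k H) * R ^ ∣ J ∣ ≤ length (kOutOutcomes k H) * Q ^ ∣ J ∣
  count-independent-kOutOutcomes-≤ J R Q on-J =
    subst₂ (λ a b → a * R ^ ∣ J ∣ ≤ b * Q ^ ∣ J ∣) (sym (count-independent-kOutOutcomes J)) (sym length-kOutOutcomes)
      (product-tabulate-*-^-≤ _ _ J R Q (λ v → count≤length _ (choicesAt k H v)) on-J)

  -- Union bound over the sets J of size s: an independent set of size at least s contains one.
  count-badEvent-≤ : (r s R Q : ℕ) →
    (∀ I → n ≤ 2 * (r * r) * ∣ I ∣ → s ≤ ∣ I ∣) →
    (∀ J → ∣ J ∣ ≡ s → ∀ v → v ∈ J → count (λ E → isIndependent E J) (choicesAt k H v) * R ≤ length (choicesAt k H v) * Q) →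
    count (λ ω → badEvent r (kOutGraph ω)) (kOutOutcomes k H) * R ^ s ≤ 2 ^ n * (length (kOutOutcomes k H) * Q ^ s)
  count-badEvent-≤ r s R Q large on-J = begin
    count (λ ω → badEvent r (kOutGraph ω)) Ω * R ^ s
      ≤⟨ *-monoˡ-≤ (R ^ s) (≤-trans (count-mono bad⇒some Ω) (count-any≤sum F (allSubsets n) Ω)) ⟩
    sum (map (λ J → count (F J) Ω) (allSubsets n)) * R ^ s
      ≤⟨ sum-map*≤length* (λ J → count (F J) Ω) (R ^ s) (length Ω * Q ^ s) each (allSubsets n) ⟩
    length (allSubsets n) * (length Ω * Q ^ s)
      ≡⟨ cong (_* (length Ω * Q ^ s)) (length-allSubsets n) ⟩
    2 ^ n * (length Ω * Q ^ s) ∎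
    where
    open ≤-Reasoning
    Ω = kOutOutcomes k H
    F : Subset n → List (List (Subset n)) → Bool
    F J ω = (∣ J ∣ ≡ᵇ s) ∧ isIndependent (kOutGraph ω) J

    bad⇒some : ∀ ω → T (badEvent r (kOutGraph ω)) → T (any (λ J → F J ω) (allSubsets n))
    bad⇒some ω bad with satisfied (any⁻ _ (allSubsets n) bad)
    ... | I , indep∧big with Equivalence.to T-∧ indep∧big
    ...   | indep , big with subset-of-size I s (large I (≤ᵇ⇒≤ n _ big))
    ...     | J , J⊆I , ∣J∣≡s = any⁺ _ (lose (∈-allSubsets J)
                (Equivalence.from T-∧ (≡⇒≡ᵇ ∣ J ∣ s ∣J∣≡s , isIndependent-⊆ (kOutGraph ω) J⊆I indep)))

    each : ∀ J → count (F J) Ω * R ^ s ≤ length Ω * Q ^ s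
    each J with ∣ J ∣ ≡ᵇ s in eq
    ... | false rewrite count-none {p = λ _ → false} (λ _ → refl) Ω = z≤n
    ... | true  with ∣J∣≡s ← ≡ᵇ⇒≡ ∣ J ∣ s (subst T (sym eq) _) rewrite sym ∣J∣≡s =
      count-independent-kOutOutcomes-≤ J R Q (on-J J refl)

-- Binomial coefficients and power estimates

n<k⇒nP′k≡0 : ∀ {n k} → n < k → n P′ k ≡ 0
n<k⇒nP′k≡0 {n} {suc k} (s≤s n≤k) = cong (_* (n P′ k)) (m≤n⇒m∸n≡0 n≤k)

nCk*k!≡nP′k : ∀ n k → (n C k) * k ! ≡ n P′ k
nCk*k!≡nP′k n k with k ≤? n
... | no  k≰n = trans (cong (_* k !) (k>n⇒nCk≡0 (≰⇒> k≰n))) (sym (n<k⇒nP′k≡0 (≰⇒> k≰n)))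
... | yes k≤n = begin
  (n C k) * k !                          ≡⟨ cong (_* k !) (nCk≡nPk/k! k≤n) ⟩
  ((n P k) / k !) * k !                  ≡⟨ m/n*n≡m (subst (k ! ∣_) nP′k≡nPk (k!∣nP′k k≤n)) ⟩
  n P k                                  ≡⟨ nP′k≡nPk ⟨
  n P′ k                                 ∎
  where
  open ≡-Reasoning
  instance
    k!≢0 : NonZero (k !)
    k!≢0 = k !≢0
    [n∸k]!≢0 : NonZero ((n ∸ k) !)
    [n∸k]!≢0 = (n ∸ k) !≢0
  nP′k≡nPk : n P′ k ≡ n P k
  nP′k≡nPk = trans (nP′k≡n!/[n∸k]! k≤n) (sym (nPk≡n!/[n∸k]! k≤n))


nP′k≤n^k : ∀ n k → n P′ k ≤ n ^ k
nP′k≤n^k n zero    = ≤-refl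
nP′k≤n^k n (suc k) = *-mono-≤ (m∸n≤m n k) (nP′k≤n^k n k)

[1+t]^k≤[k+t]P′k : ∀ t k → suc t ^ k ≤ (k + t) P′ k
[1+t]^k≤[k+t]P′k t zero    = ≤-refl
[1+t]^k≤[k+t]P′k t (suc k) = begin
  suc t * suc t ^ k             ≤⟨ *-mono-≤ (s≤s (m≤n+m t k)) ([1+t]^k≤[k+t]P′k t k) ⟩
  suc (k + t) * ((k + t) P′ k)  ≡⟨ nP′k≡n[n∸1P′k∸1] (suc k + t) (suc k) ⟨
  (suc k + t) P′ suc k          ∎
  where open ≤-Reasoning

xP′k*d^k≤dP′k*x^k : ∀ {x d} k → x ≤ d → (x P′ k) * d ^ k ≤ (d P′ k) * x ^ k
xP′k*d^k≤dP′k*x^k zero x≤d = ≤-refl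
xP′k*d^k≤dP′k*x^k {x} {d} (suc k) x≤d = begin
  (x ∸ k) * (x P′ k) * (d * d ^ k)   ≡⟨ *-CS.interchange (x ∸ k) (x P′ k) d (d ^ k) ⟩
  (x ∸ k) * d * ((x P′ k) * d ^ k)   ≤⟨ *-mono-≤ factor (xP′k*d^k≤dP′k*x^k k x≤d) ⟩
  (d ∸ k) * x * ((d P′ k) * x ^ k)   ≡⟨ *-CS.interchange (d ∸ k) (d P′ k) x (x ^ k) ⟨
  (d ∸ k) * (d P′ k) * (x * x ^ k)   ∎
  where
  open ≤-Reasoning
  factor : (x ∸ k) * d ≤ (d ∸ k) * x
  factor = begin
    (x ∸ k) * d   ≡⟨ *-distribʳ-∸ d x k ⟩
    x * d ∸ k * d ≤⟨ ∸-monoʳ-≤ (x * d) (*-monoʳ-≤ k x≤d) ⟩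
    x * d ∸ k * x ≡⟨ cong (_∸ k * x) (*-comm x d) ⟩
    d * x ∸ k * x ≡⟨ *-distribʳ-∸ x d k ⟨
    (d ∸ k) * x   ∎

xCk*d^k≤dCk*x^k : ∀ {x d} k → x ≤ d → (x C k) * d ^ k ≤ (d C k) * x ^ k
xCk*d^k≤dCk*x^k {x} {d} k x≤d = *-cancelʳ-≤ _ _ (k !) {{k !≢0}} (begin
  (x C k) * d ^ k * k !   ≡⟨ *-CS.xy∙z≈xz∙y (x C k) (d ^ k) (k !) ⟩
  (x C k) * k ! * d ^ k   ≡⟨ cong (_* d ^ k) (nCk*k!≡nP′k x k) ⟩
  (x P′ k) * d ^ k        ≤⟨ xP′k*d^k≤dP′k*x^k k x≤d ⟩
  (d P′ k) * x ^ k        ≡⟨ cong (_* x ^ k) (nCk*k!≡nP′k d k) ⟨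
  (d C k) * k ! * x ^ k   ≡⟨ *-CS.xy∙z≈xz∙y (d C k) (k !) (x ^ k) ⟩
  (d C k) * x ^ k * k !   ∎)
  where open ≤-Reasoning

bernoulli : ∀ x e c → x ^ suc c + suc c * e * x ^ c ≤ (x + e) ^ suc c
bernoulli x e zero    = ≤-reflexive (base x e)
  where base : ∀ x e → x * 1 + 1 * e * 1 ≡ (x + e) * 1
        base = solve-∀
bernoulli x e (suc c) = begin
  x ^ suc (suc c) + suc (suc c) * e * x ^ suc c
    ≤⟨ m≤m+n _ (suc c * e * e * x ^ c) ⟩
  x ^ suc (suc c) + suc (suc c) * e * x ^ suc c + suc c * e * e * x ^ c
    ≡⟨ expand x e c (x ^ c) ⟨
  (x + e) * (x ^ suc c + suc c * e * x ^ c)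
    ≤⟨ *-monoʳ-≤ (x + e) (bernoulli x e c) ⟩
  (x + e) ^ suc (suc c) ∎
  where
  open ≤-Reasoning
  expand : ∀ x e c X → (x + e) * (x * X + (1 + c) * e * X) ≡ x * (x * X) + (2 + c) * e * (x * X) + (1 + c) * e * e * X
  expand = solve-∀

[m*n]^o≡m^o*n^o : ∀ m n o → (m * n) ^ o ≡ m ^ o * n ^ o
[m*n]^o≡m^o*n^o m n zero    = refl
[m*n]^o≡m^o*n^o m n (suc o) = trans (cong (m * n *_) ([m*n]^o≡m^o*n^o m n o)) (*-CS.interchange m n (m ^ o) (n ^ o))

3*x^[1+c]≤2*[x+e]^[1+c] : ∀ x e c → x ≤ 2 * suc c * e → 3 * x ^ suc c ≤ 2 * (x + e) ^ suc c
3*x^[1+c]≤2*[x+e]^[1+c] x e c x≤2[1+c]e = begin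
  3 * x ^ suc c                         ≡⟨ split (x ^ c) x ⟩
  2 * x ^ suc c + x * x ^ c             ≤⟨ +-monoʳ-≤ (2 * x ^ suc c) (*-monoˡ-≤ (x ^ c) x≤2[1+c]e) ⟩
  2 * x ^ suc c + 2 * suc c * e * x ^ c ≡⟨ gather (x ^ suc c) c e (x ^ c) ⟩
  2 * (x ^ suc c + suc c * e * x ^ c)   ≤⟨ *-monoʳ-≤ 2 (bernoulli x e c) ⟩
  2 * (x + e) ^ suc c                   ∎
  where
  open ≤-Reasoning
  split : ∀ X x → 3 * (x * X) ≡ 2 * (x * X) + x * X
  split = solve-∀
  gather : ∀ A c e X → 2 * A + 2 * (1 + c) * e * X ≡ 2 * (A + (1 + c) * e * X)
  gather = solve-∀

-- (x C k) / (d C k) ≤ (x / d)^k for d = e + x, and (x / d)^b ≤ 2/3 by Bernoulli's inequality.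
xC[bc]*3^c≤[e+x]C[bc]*2^c : ∀ b c {e x} → 0 < b → 0 < e → x ≤ 2 * b * e →
                            (x C (b * c)) * 3 ^ c ≤ ((e + x) C (b * c)) * 2 ^ c
xC[bc]*3^c≤[e+x]C[bc]*2^c (suc b) c {e} {x} _ 0<e x≤2be = *-cancelʳ-≤ _ _ (d ^ k) {{m^n≢0 d k {{>-nonZero 0<d}}}} (begin
  (x C k) * 3 ^ c * d ^ k   ≡⟨ *-CS.xy∙z≈y∙xz (x C k) (3 ^ c) (d ^ k) ⟩
  3 ^ c * ((x C k) * d ^ k) ≤⟨ *-monoʳ-≤ (3 ^ c) (xCk*d^k≤dCk*x^k k (m≤n+m x e)) ⟩
  3 ^ c * ((d C k) * x ^ k) ≡⟨ *-CS.x∙yz≈y∙xz (3 ^ c) (d C k) (x ^ k) ⟩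
  (d C k) * (3 ^ c * x ^ k) ≤⟨ *-monoʳ-≤ (d C k) powers ⟩
  (d C k) * (2 ^ c * d ^ k) ≡⟨ *-assoc (d C k) (2 ^ c) (d ^ k) ⟨
  (d C k) * 2 ^ c * d ^ k   ∎)
  where
  open ≤-Reasoning
  k = suc b * c
  d = e + x
  0<d : 0 < d
  0<d = ≤-trans 0<e (m≤m+n e x)
  powers : 3 ^ c * x ^ k ≤ 2 ^ c * d ^ k
  powers = begin
    3 ^ c * x ^ k               ≡⟨ cong (3 ^ c *_) (^-*-assoc x (suc b) c) ⟨
    3 ^ c * (x ^ suc b) ^ c     ≡⟨ [m*n]^o≡m^o*n^o 3 (x ^ suc b) c ⟨
    (3 * x ^ suc b) ^ c         ≤⟨ ^-monoˡ-≤ c (3*x^[1+c]≤2*[x+e]^[1+c] x e b x≤2be) ⟩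
    (2 * (x + e) ^ suc b) ^ c   ≡⟨ [m*n]^o≡m^o*n^o 2 ((x + e) ^ suc b) c ⟩
    2 ^ c * ((x + e) ^ suc b) ^ c ≡⟨ cong (2 ^ c *_) (trans (^-*-assoc (x + e) (suc b) c) (cong (_^ k) (+-comm x e))) ⟩
    2 ^ c * d ^ k               ∎

[t+r]*[z∸r]≤t*z : ∀ {t z} r → z ≤ t → (t + r) * (z ∸ r) ≤ t * z
[t+r]*[z∸r]≤t*z {t} {z} r z≤t with r ≤? z
... | no r≰z rewrite m≤n⇒m∸n≡0 (<⇒≤ (≰⇒> r≰z)) | *-zeroʳ (t + r) = z≤n
... | yes r≤z = begin
  (t + r) * (z ∸ r)         ≡⟨ *-distribʳ-+ (z ∸ r) t r ⟩
  t * (z ∸ r) + r * (z ∸ r) ≤⟨ +-monoʳ-≤ (t * (z ∸ r)) (≤-trans (≤-reflexive (*-comm r (z ∸ r))) (*-monoˡ-≤ r (≤-trans (m∸n≤m z r) z≤t))) ⟩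
  t * (z ∸ r) + t * r       ≡⟨ *-distribˡ-+ t (z ∸ r) r ⟨
  t * (z ∸ r + r)           ≡⟨ cong (t *_) (m∸n+n≡m r≤z) ⟩
  t * z                     ∎
  where open ≤-Reasoning

[t+r]^p*[t∸p*r]≤t^[1+p] : ∀ t r p → (t + r) ^ p * (t ∸ p * r) ≤ t ^ suc p
[t+r]^p*[t∸p*r]≤t^[1+p] t r zero    = ≤-reflexive (trans (+-identityʳ t) (sym (*-identityʳ t)))
[t+r]^p*[t∸p*r]≤t^[1+p] t r (suc p) = begin
  (t + r) * (t + r) ^ p * (t ∸ (r + p * r)) ≡⟨ cong ((t + r) * (t + r) ^ p *_) t∸[r+pr]≡z∸r ⟩
  (t + r) * (t + r) ^ p * (z ∸ r)           ≡⟨ *-CS.xy∙z≈y∙xz (t + r) ((t + r) ^ p) (z ∸ r) ⟩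
  (t + r) ^ p * ((t + r) * (z ∸ r))         ≤⟨ *-monoʳ-≤ ((t + r) ^ p) ([t+r]*[z∸r]≤t*z r (m∸n≤m t (p * r))) ⟩
  (t + r) ^ p * (t * z)                     ≡⟨ *-CS.x∙yz≈y∙xz ((t + r) ^ p) t z ⟩
  t * ((t + r) ^ p * z)                     ≤⟨ *-monoʳ-≤ t ([t+r]^p*[t∸p*r]≤t^[1+p] t r p) ⟩
  t * t ^ suc p                             ∎
  where
  open ≤-Reasoning
  z = t ∸ p * r
  t∸[r+pr]≡z∸r : t ∸ (r + p * r) ≡ z ∸ r
  t∸[r+pr]≡z∸r = trans (cong (t ∸_) (+-comm r (p * r))) (sym (∸-+-assoc t (p * r) r))

a*[t+r]^p≤[1+a]*t^p : ∀ a t r p → 0 < t → suc a * (p * r) ≤ t → a * (t + r) ^ p ≤ suc a * t ^ p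
a*[t+r]^p≤[1+a]*t^p a t r p 0<t small = *-cancelʳ-≤ _ _ t {{>-nonZero 0<t}} (begin
  a * (t + r) ^ p * t                 ≡⟨ *-CS.xy∙z≈y∙xz a ((t + r) ^ p) t ⟩
  (t + r) ^ p * (a * t)               ≤⟨ *-monoʳ-≤ ((t + r) ^ p) at≤[1+a][t∸pr] ⟩
  (t + r) ^ p * (suc a * (t ∸ p * r)) ≡⟨ *-CS.x∙yz≈y∙xz ((t + r) ^ p) (suc a) (t ∸ p * r) ⟩
  suc a * ((t + r) ^ p * (t ∸ p * r)) ≤⟨ *-monoʳ-≤ (suc a) ([t+r]^p*[t∸p*r]≤t^[1+p] t r p) ⟩
  suc a * (t * t ^ p)                 ≡⟨ *-CS.x∙yz≈xz∙y (suc a) t (t ^ p) ⟩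
  suc a * t ^ p * t                   ∎)
  where
  open ≤-Reasoning
  at≤[1+a][t∸pr] : a * t ≤ suc a * (t ∸ p * r)
  at≤[1+a][t∸pr] = begin
    a * t                       ≡⟨ m+n∸m≡n t (a * t) ⟨
    suc a * t ∸ t               ≤⟨ ∸-monoʳ-≤ (suc a * t) small ⟩
    suc a * t ∸ suc a * (p * r) ≡⟨ *-distribˡ-∸ (suc a) t (p * r) ⟨
    suc a * (t ∸ p * r)         ∎

-- p! C(n-1, p) ≤ (n-1)^p ≤ w^p (s+1)^p ≤ (1 + w^p)(s-p)^p ≤ (1 + w^p) p! C(s-1, p), the third step once s is large.
[n∸1]Cp≤[1+w^p]*[s∸1]Cp : ∀ p w {n s} → n ≤ w * s + w → suc p + suc (w ^ p) * (p * suc p) ≤ s →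
                          (n ∸ 1) C p ≤ suc (w ^ p) * ((s ∸ 1) C p)
[n∸1]Cp≤[1+w^p]*[s∸1]Cp p w {n} {s} n≤ws+w s-large =
  subst (λ s → (n ∸ 1) C p ≤ suc W * ((s ∸ 1) C p)) s≡1+p+t (*-cancelʳ-≤ _ _ (p !) {{p !≢0}} (begin
    ((n ∸ 1) C p) * p !             ≡⟨ nCk*k!≡nP′k (n ∸ 1) p ⟩
    (n ∸ 1) P′ p                    ≤⟨ nP′k≤n^k (n ∸ 1) p ⟩
    (n ∸ 1) ^ p                     ≤⟨ ^-monoˡ-≤ p (≤-trans (m∸n≤m n 1) (≤-trans n≤ws+w (≤-reflexive ws+w≡))) ⟩
    (w * (suc t + suc p)) ^ p       ≡⟨ [m*n]^o≡m^o*n^o w (suc t + suc p) p ⟩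
    W * (suc t + suc p) ^ p         ≤⟨ a*[t+r]^p≤[1+a]*t^p W (suc t) (suc p) p z<s t-large ⟩
    suc W * suc t ^ p               ≤⟨ *-monoʳ-≤ (suc W) ([1+t]^k≤[k+t]P′k t p) ⟩
    suc W * ((p + t) P′ p)          ≡⟨ cong (suc W *_) (nCk*k!≡nP′k (p + t) p) ⟨
    suc W * (((p + t) C p) * p !)   ≡⟨ *-assoc (suc W) ((p + t) C p) (p !) ⟨
    suc W * ((p + t) C p) * p !     ∎))
  where
  open ≤-Reasoning
  W = w ^ p
  t = s ∸ suc p
  s≡1+p+t : suc p + t ≡ s
  s≡1+p+t = m+[n∸m]≡n (≤-trans (m≤m+n (suc p) _) s-large)
  t-large : suc W * (p * suc p) ≤ suc t
  t-large = ≤-trans (+-cancelˡ-≤ (suc p) _ _ (≤-trans s-large (≤-reflexive (sym s≡1+p+t)))) (n≤1+n t)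
  ws+w≡ : w * s + w ≡ w * (suc t + suc p)
  ws+w≡ = trans (cong (λ s → w * s + w) (sym s≡1+p+t)) (shuffle w p t)
    where shuffle : ∀ w p t → w * (suc p + t) + w ≡ w * (suc t + suc p)
          shuffle = solve-∀

k≤n⇒0<nCk : ∀ {n k} → k ≤ n → 0 < n C k
k≤n⇒0<nCk {n}     {zero}  _         = z<s
k≤n⇒0<nCk {suc n} {suc k} (s≤s k≤n) =
  ≤-trans (k≤n⇒0<nCk k≤n) (≤-trans (m≤m+n (n C k) (n C suc k)) (≤-reflexive (nCk+nC[k+1]≡[n+1]C[k+1] n k)))

m≤n*[m/n]+n : ∀ m n .{{_ : NonZero n}} → m ≤ n * (m / n) + n
m≤n*[m/n]+n m n = begin
  m                   ≡⟨ m≡m%n+[m/n]*n m n ⟩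
  m % n + (m / n) * n ≤⟨ +-monoˡ-≤ ((m / n) * n) (<⇒≤ (m%n<n m n)) ⟩
  n + (m / n) * n     ≡⟨ trans (+-comm n _) (cong (_+ n) (*-comm (m / n) n)) ⟩
  n * (m / n) + n     ∎
  where open ≤-Reasoning

m≤n*k⇒m/n≤k : ∀ {m k} n .{{_ : NonZero n}} → m ≤ n * k → m / n ≤ k
m≤n*k⇒m/n≤k {m} {k} n m≤nk = ≤-trans (/-monoˡ-≤ n m≤nk) (≤-reflexive (trans (cong (_/ n) (*-comm n k)) (m*n/n≡m k n)))

n*k≤m⇒k≤m/n : ∀ {m k} n .{{_ : NonZero n}} → n * k ≤ m → k ≤ m / n
n*k≤m⇒k≤m/n {m} {k} n nk≤m = ≤-trans (≤-reflexive (sym (m*n/n≡m k n))) (/-monoˡ-≤ n (≤-trans (≤-reflexive (*-comm k n)) nk≤m))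

[a^[2w]]^s≡[a*a]^[w*s] : ∀ a w s → (a ^ (2 * w)) ^ s ≡ (a * a) ^ (w * s)
[a^[2w]]^s≡[a*a]^[w*s] a w s = begin
  (a ^ (2 * w)) ^ s ≡⟨ ^-*-assoc a (2 * w) s ⟩
  a ^ (2 * w * s)   ≡⟨ cong (a ^_) (*-assoc 2 w s) ⟩
  a ^ (2 * (w * s)) ≡⟨ ^-*-assoc a 2 (w * s) ⟨
  (a ^ 2) ^ (w * s) ≡⟨ cong (λ z → (a * z) ^ (w * s)) (*-identityʳ a) ⟩
  (a * a) ^ (w * s) ∎
  where open ≡-Reasoning

8^u*[8+u]≤8*9^u : ∀ u → 8 ^ u * (8 + u) ≤ 8 * 9 ^ u
8^u*[8+u]≤8*9^u zero    = ≤-refl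
8^u*[8+u]≤8*9^u (suc u) = begin
  8 ^ suc u * (8 + suc u)               ≡⟨ regroup (8 ^ u) u ⟩
  8 * (8 ^ suc u + suc u * 1 * 8 ^ u)   ≤⟨ *-monoʳ-≤ 8 (bernoulli 8 1 u) ⟩
  8 * 9 ^ suc u                         ∎
  where
  open ≤-Reasoning
  regroup : ∀ X u → 8 * X * (8 + suc u) ≡ 8 * (8 * X + suc u * 1 * X)
  regroup = solve-∀

[1+m]*2^n*4^u≤9^u : ∀ m w u n → n ≤ u + w → 8 * (suc m * 2 ^ w) ≤ 8 + u → suc m * 2 ^ n * 4 ^ u ≤ 9 ^ u
[1+m]*2^n*4^u≤9^u m w u n n≤u+w u-large = *-cancelʳ-≤ _ _ 8 (begin
  suc m * 2 ^ n * 4 ^ u * 8             ≤⟨ *-monoˡ-≤ 8 (*-monoˡ-≤ (4 ^ u) (*-monoʳ-≤ (suc m) (^-monoʳ-≤ 2 n≤u+w))) ⟩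
  suc m * 2 ^ (u + w) * 4 ^ u * 8       ≡⟨ cong (λ z → suc m * z * 4 ^ u * 8) (^-distribˡ-+-* 2 u w) ⟩
  suc m * (2 ^ u * 2 ^ w) * 4 ^ u * 8   ≡⟨ regroup (suc m) (2 ^ u) (2 ^ w) (4 ^ u) ⟩
  8 * (suc m * 2 ^ w) * (2 ^ u * 4 ^ u) ≡⟨ cong (8 * (suc m * 2 ^ w) *_) ([m*n]^o≡m^o*n^o 2 4 u) ⟨
  8 * (suc m * 2 ^ w) * 8 ^ u           ≤⟨ *-monoˡ-≤ (8 ^ u) u-large ⟩
  (8 + u) * 8 ^ u                       ≡⟨ *-comm (8 + u) (8 ^ u) ⟩
  8 ^ u * (8 + u)                       ≤⟨ 8^u*[8+u]≤8*9^u u ⟩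
  8 * 9 ^ u                             ≡⟨ *-comm 8 (9 ^ u) ⟩
  9 ^ u * 8                             ∎)
  where
  open ≤-Reasoning
  regroup : ∀ m a b c → m * (a * b) * c * 8 ≡ 8 * (m * b) * (a * c)
  regroup = solve-∀

-- The complete r-graph

c⁻¹ : ℕ → ℕ
c⁻¹ r = 2 * (r * r)

count-star-⊆ : ∀ p {n} (v : Fin n) (J : Subset n) → v ∈ J →
  count (_⊆ᵇ J) (star (completeGraph (suc p) n) v) ≡ (∣ J ∣ ∸ 1) C p
count-star-⊆ p {n} v J v∈J = begin
  count (_⊆ᵇ J) (filterᵇ (λ A → does (v ∈? A)) (filterᵇ (λ A → ∣ A ∣ ≡ᵇ suc p) (allSubsets n)))
    ≡⟨ count-filterᵇ (_⊆ᵇ J) (λ A → does (v ∈? A)) (filterᵇ (λ A → ∣ A ∣ ≡ᵇ suc p) (allSubsets n)) ⟩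
  count (λ A → does (v ∈? A) ∧ A ⊆ᵇ J) (filterᵇ (λ A → ∣ A ∣ ≡ᵇ suc p) (allSubsets n))
    ≡⟨ count-filterᵇ (λ A → does (v ∈? A) ∧ A ⊆ᵇ J) (λ A → ∣ A ∣ ≡ᵇ suc p) (allSubsets n) ⟩
  count (λ A → (∣ A ∣ ≡ᵇ suc p) ∧ (does (v ∈? A) ∧ A ⊆ᵇ J)) (allSubsets n)
    ≡⟨ count-cong reorder (allSubsets n) ⟩
  count (between ⁅ v ⁆ J p) (allSubsets n)
    ≡⟨ count-between ⁅ v ⁆ J (Equivalence.to ∈⇔⁅⁆⊆ v∈J) p ⟩
  (∣ J ∣ ∸ ∣ ⁅ v ⁆ ∣) C p
    ≡⟨ cong (λ m → (∣ J ∣ ∸ m) C p) (∣⁅x⁆∣≡1 v) ⟩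
  (∣ J ∣ ∸ 1) C p ∎
  where
  open ≡-Reasoning
  reorder : ∀ A → (∣ A ∣ ≡ᵇ suc p) ∧ (does (v ∈? A) ∧ A ⊆ᵇ J) ≡ between ⁅ v ⁆ J p A
  reorder A rewrite ∣⁅x⁆∣≡1 v | does-⇔ ∈⇔⁅⁆⊆ (v ∈? A) (⁅ v ⁆ ⊆? A) =
    trans (∧-comm (∣ A ∣ ≡ᵇ suc p) _) (∧-assoc (⁅ v ⁆ ⊆ᵇ A) (A ⊆ᵇ J) _)

length-star : ∀ p {n} (v : Fin n) → length (star (completeGraph (suc p) n) v) ≡ (n ∸ 1) C p
length-star p {n} v = begin
  length (star K v)             ≡⟨ count-all-true (star K v) ⟨
  count (_⊆ᵇ ⊤) (star K v)      ≡⟨ count-star-⊆ p v ⊤ (⊆⊤ (x∈⁅x⁆ v)) ⟩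
  (∣ ⊤ {n} ∣ ∸ 1) C p           ≡⟨ cong (λ m → (m ∸ 1) C p) (∣⊤∣≡n n) ⟩
  (n ∸ 1) C p                   ∎
  where
  open ≡-Reasoning
  K = completeGraph (suc p) n
  count-all-true : (xs : List (Subset n)) → count (_⊆ᵇ ⊤) xs ≡ length xs
  count-all-true [] = refl
  count-all-true (A ∷ xs) rewrite dec-true (A ⊆? ⊤) ⊆⊤ = cong suc (count-all-true xs)

-- k = (2r²)^r factors as b · c with b = r² (2r²)^(r-2) and c = 4r², so that 2b = (2r²)^(r-1).
vertex-ratio-2≤r : ∀ p {e x} → 0 < e → e + x ≤ suc (c⁻¹ (suc (suc p)) ^ suc p) * e →
             (x C kOf (suc (suc p))) * 3 ^ (2 * c⁻¹ (suc (suc p))) ≤ ((e + x) C kOf (suc (suc p))) * 2 ^ (2 * c⁻¹ (suc (suc p)))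
vertex-ratio-2≤r p {e} {x} 0<e e+x≤ =
  subst (λ k → (x C k) * 3 ^ c ≤ ((e + x) C k) * 2 ^ c) (sym k≡bc) (xC[bc]*3^c≤[e+x]C[bc]*2^c b c 0<b 0<e x≤2be)
  where
  A = suc (suc p) * suc (suc p)
  W = c⁻¹ (suc (suc p)) ^ p
  b = A * W
  c = 2 * c⁻¹ (suc (suc p))
  0<b : 0 < b
  0<b = *-mono-≤ {1} {A} {1} {W} (s≤s z≤n) (m^n>0 (2 * A) p)
  k≡bc : kOf (suc (suc p)) ≡ b * c
  k≡bc = regroup A W
    where regroup : ∀ A W → 2 * A * (2 * A * W) ≡ A * W * (2 * (2 * A))
          regroup = solve-∀
  x≤2be : x ≤ 2 * b * e
  x≤2be = ≤-trans (+-cancelˡ-≤ e x _ e+x≤) (≤-reflexive (regroup A W e))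
    where regroup : ∀ A W e → 2 * A * W * e ≡ 2 * (A * W) * e
          regroup = solve-∀

vertex-ratio : ∀ p a b {x} → b C p + x ≡ a C p → a C p ≤ suc (c⁻¹ (suc p) ^ p) * (b C p) → 0 < b C p →
               (x C kOf (suc p)) * 3 ^ (2 * c⁻¹ (suc p)) ≤ ((a C p) C kOf (suc p)) * 2 ^ (2 * c⁻¹ (suc p))
-- For r = 1 the star of v is its single edge, which lies inside J, so x = 0.
vertex-ratio zero    a b {zero}  _  _ _ = z≤n
vertex-ratio zero    a b {suc x} eq _ _ with () ← suc-injective eq
vertex-ratio (suc p) a b {x} eq a≤ 0<e =
  subst (λ D → (x C kOf (suc (suc p))) * 3 ^ (2 * c⁻¹ (suc (suc p))) ≤ (D C kOf (suc (suc p))) * 2 ^ (2 * c⁻¹ (suc (suc p))))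
        eq (vertex-ratio-2≤r p 0<e (subst (_≤ _) (sym eq) a≤))

count-independent-choicesAt-complete-≤ : ∀ p {n} k (J : Subset n) (v : Fin n) (R Q : ℕ) → v ∈ J → 0 < (∣ J ∣ ∸ 1) C p →
  (∀ x → (∣ J ∣ ∸ 1) C p + x ≡ (n ∸ 1) C p → (x C k) * R ≤ (((n ∸ 1) C p) C k) * Q) →
  count (λ E → isIndependent E J) (choicesAt k (completeGraph (suc p) n) v) * R
    ≤ length (choicesAt k (completeGraph (suc p) n) v) * Q
count-independent-choicesAt-complete-≤ p {n} k J v R Q v∈J 0<e bound =
  count-independent-choicesAt-≤ k K J v R Q (subst (0 <_) (sym #inside≡) 0<e)
    (subst (λ D → (#outside C k) * R ≤ (D C k) * Q) (sym (length-star p v)) (bound #outside split))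
  where
  K = completeGraph (suc p) n
  #outside : ℕ
  #outside = count (not ∘ (_⊆ᵇ J)) (star K v)
  #inside≡ : count (_⊆ᵇ J) (star K v) ≡ (∣ J ∣ ∸ 1) C p
  #inside≡ = count-star-⊆ p v J v∈J
  split : (∣ J ∣ ∸ 1) C p + #outside ≡ (n ∸ 1) C p
  split = trans (cong (_+ #outside) (sym #inside≡)) (trans (count+count-not (_⊆ᵇ J) (star K v)) (length-star p v))

complete-kOut-bad≤ : ∀ p n s m →
  (∀ (I : Subset n) → n ≤ c⁻¹ (suc p) * ∣ I ∣ → s ≤ ∣ I ∣) →
  (n ∸ 1) C p ≤ suc (c⁻¹ (suc p) ^ p) * ((s ∸ 1) C p) →
  0 < (s ∸ 1) C p →
  suc m * 2 ^ n * 4 ^ (c⁻¹ (suc p) * s) ≤ 9 ^ (c⁻¹ (suc p) * s) →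
  suc m * badCount (suc p) n ≤ totalCount (suc p) n
complete-kOut-bad≤ p n s m large D≤ 0<e margin = *-cancelʳ-≤ _ _ (9 ^ u) {{m^n≢0 9 u}} (begin
  suc m * bad * 9 ^ u                ≡⟨ *-assoc (suc m) bad (9 ^ u) ⟩
  suc m * (bad * 9 ^ u)              ≤⟨ *-monoʳ-≤ (suc m) bad-bound ⟩
  suc m * (2 ^ n * (total * 4 ^ u))  ≡⟨ regroup (suc m) (2 ^ n) total (4 ^ u) ⟩
  total * (suc m * 2 ^ n * 4 ^ u)    ≤⟨ *-monoʳ-≤ total margin ⟩
  total * 9 ^ u                      ∎)
  where
  open ≤-Reasoning
  r = suc p
  k = kOf r
  w = c⁻¹ r
  u = w * s
  bad = badCount r n
  total = totalCount r n
  regroup : ∀ m a t b → m * (a * (t * b)) ≡ t * (m * a * b)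
  regroup = solve-∀
  per-vertex : ∀ J → ∣ J ∣ ≡ s → ∀ v → v ∈ J →
    count (λ E → isIndependent E J) (choicesAt k (completeGraph r n) v) * 3 ^ (2 * w)
      ≤ length (choicesAt k (completeGraph r n) v) * 2 ^ (2 * w)
  per-vertex J ∣J∣≡s v v∈J = count-independent-choicesAt-complete-≤ p k J v _ _ v∈J
    (subst (λ z → 0 < (z ∸ 1) C p) (sym ∣J∣≡s) 0<e)
    (λ x split → vertex-ratio p (n ∸ 1) (s ∸ 1) (subst (λ z → (z ∸ 1) C p + x ≡ _) ∣J∣≡s split) D≤ 0<e)
  bad-bound : bad * 9 ^ u ≤ 2 ^ n * (total * 4 ^ u)
  bad-bound = subst₂ (λ R Q → bad * R ≤ 2 ^ n * (total * Q)) ([a^[2w]]^s≡[a*a]^[w*s] 3 w s) ([a^[2w]]^s≡[a*a]^[w*s] 2 w s)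
                (count-badEvent-≤ k (completeGraph r n) r s (3 ^ (2 * w)) (2 ^ (2 * w)) large per-vertex)

lemma6 : (r : ℕ) → 1 ≤ r → (m : ℕ) → ∃[ N ] ((n : ℕ) → N ≤ n → suc m * badCount r n ≤ totalCount r n)
lemma6 (suc p) _ m = w * S , bound
  where
  w = c⁻¹ (suc p)
  C = suc m * 2 ^ w
  X = suc (w ^ p) * (p * suc p)
  -- s = ⌊n / w⌋ ≥ S gives both s ≥ r + X, needed to compare star sizes, and the margin 8C ≤ w s.
  S = suc p + X + 8 * C
  bound : (n : ℕ) → w * S ≤ n → suc m * badCount (suc p) n ≤ totalCount (suc p) n
  bound n wS≤n = complete-kOut-bad≤ p n s m
      (λ I → m≤n*k⇒m/n≤k w)
      ([n∸1]Cp≤[1+w^p]*[s∸1]Cp p w n≤ws+w s-large)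
      (k≤n⇒0<nCk (∸-monoˡ-≤ 1 (≤-trans (m≤m+n (suc p) X) s-large)))
      ([1+m]*2^n*4^u≤9^u m w (w * s) n n≤ws+w ws-large)
    where
    s = n / w
    S≤s : S ≤ s
    S≤s = n*k≤m⇒k≤m/n w wS≤n
    n≤ws+w : n ≤ w * s + w
    n≤ws+w = m≤n*[m/n]+n n w
    s-large : suc p + X ≤ s
    s-large = ≤-trans (m≤m+n (suc p + X) (8 * C)) S≤s
    ws-large : 8 * C ≤ 8 + w * s
    ws-large = ≤-trans (≤-trans (m≤n+m (8 * C) (suc p + X)) S≤s) (≤-trans (m≤n*m s w) (m≤n+m (w * s) 8))
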